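{- For every positive integer $n$, the simplicial complex $T_{3,n}$ is shellable.
   Context: $T_{3,n}$ is the simplicial complex on the vertex set $[n]\times\{1,2,3\}$ whose faces are the subsets $S\subseteq[n]\times\{1,2,3\}$ containing at most one element $(j,i)$ for each $j\in[n]$, except the three sets $\{(j,c): j\in[n]\}$ for $c=1,2,3$. Equivalently, faces correspond to strings in $\{0,1,2,3\}^n$ (entry $X_j=i$ if $(j,i)\in S$, $X_j=0$ if no element has first coordinate $j$), the face of a string being obtained by changing nonzero entries to $0$; its facets are the strings in $\{1,2,3\}^n$ other than $(1,\ldots,1),(2,\ldots,2),(3,\ldots,3)$. This complex is the space of $3\times n$ real matrices of tropical rank two (over $(\mathbb{R},\min,+)$), i.e. configurations of $n$ labeled points on a tropical line in $\mathbb{TP}^2$, modulo translations and positive dilation, with the cone point removed. -}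

module Defs where

open import Data.Nat using (ℕ; zero; suc; _<_; _≤_)
open import Data.Fin using (Fin; toℕ) renaming (zero to fz; suc to fs)
open import Data.Vec using (Vec; []; _∷_; replicate)
open import Data.Vec.Relation.Binary.Pointwise.Inductive using (Pointwise)
open import Data.List using (List; length; lookup)
open import Data.List.Membership.Propositional using (_∈_)
open import Data.List.Relation.Unary.Unique.Propositional using (Unique)
open import Data.Product using (Σ; ∃; _×_)
open import Data.Sum using (_⊎_)
open import Relation.Binary.PropositionalEquality using (_≡_)
open import Relation.Nullary using (¬_)
open import Function.Bundles using (_⇔_)

-- A subset S of [n] × {1,2,3} with at most one element (j,i) per j is encoded
-- as a string X ∈ {0,1,2,3}^n : X_j = i if (j,i) ∈ S, X_j = 0 otherwise.
Str : ℕ → Set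
Str n = Vec (Fin 4) n

_≼_ : Fin 4 → Fin 4 → Set
x ≼ y = (x ≡ fz) ⊎ (x ≡ y)

_⊑_ : ∀ {n} → Str n → Str n → Set
X ⊑ Y = Pointwise _≼_ X Y

size : ∀ {n} → Str n → ℕ
size [] = 0
size (fz ∷ xs) = size xs
size (fs _ ∷ xs) = suc (size xs)

T3 : (n : ℕ) → Str n → Set
T3 n X = ¬ (X ≡ replicate n (fs fz))
       × ¬ (X ≡ replicate n (fs (fs fz)))
       × ¬ (X ≡ replicate n (fs (fs (fs fz))))

-- Generic notions for a simplicial complex Δ (given by its face predicate)
-- on vertex set [n] × {1,2,3}, restricted to faces of the above shape.
IsFacet : ∀ {n} → (Str n → Set) → Str n → Set
IsFacet Δ F = Δ F × (∀ G → Δ G → F ⊑ G → G ≡ F)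

-- Shelling condition (Björner–Wachs): for k ≥ 2 (0-based index k > 0), the
-- subcomplex ⟨F_k⟩ ∩ (⟨F_1⟩ ∪ … ∪ ⟨F_{k-1}⟩) is pure of dimension dim F_k − 1,
-- i.e. each of its faces lies in one of its faces of cardinality |F_k| − 1
-- (no face of cardinality |F_k| occurs since the facets are distinct).
InPrefix : ∀ {n} (L : List (Str n)) → Fin (length L) → Str n → Set
InPrefix L k G = Σ (Fin (length L)) λ i → (toℕ i < toℕ k) × (G ⊑ lookup L i)

ShellingStep : ∀ {n} (L : List (Str n)) → Fin (length L) → Set
ShellingStep {n} L k =
  ∀ (G : Str n) → G ⊑ lookup L k → InPrefix L k G →
    Σ (Str n) λ H → (G ⊑ H) × (H ⊑ lookup L k) × InPrefix L k H
                  × (suc (size H) ≡ size (lookup L k))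

IsShelling : ∀ {n} → (Str n → Set) → List (Str n) → Set
IsShelling {n} Δ L =
  Unique L
  × (∀ (F : Str n) → (F ∈ L) ⇔ IsFacet Δ F)
  × (∀ (k : Fin (length L)) → 0 < toℕ k → ShellingStep L k)

Shellable : ∀ {n} → (Str n → Set) → Set
Shellable {n} Δ = Σ (List (Str n)) λ L → IsShelling Δ L

-- For n ≥ 2 the facets of T_{3,n} are the non-constant words in {1,2,3}ⁿ. They are shelled
-- recursively in three blocks, by first letter a = 1, 2, 3: block a lists a·w for w running
-- through the shelling for n − 1, followed by the two words a·cⁿ⁻¹ with c ≠ a. Inside a block the
-- shelling condition for a·w is inherited from w; an earlier facet with another first letter meets
-- a·w inside 0·w ⊆ 1·w, which lies in block 1; and an earlier facet b·t meets a·cⁿ⁻¹ either inside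
-- b·cⁿ⁻¹ (if t = cⁿ⁻¹) or inside a·(cⁿ⁻¹ with the letter at a position where t differs from c
-- changed), which was listed before. The six facets for n = 2 are ordered by hand, and T_{3,1}
-- has the empty face as its only facet.

module Submission where

open import Defs
open import Data.Nat using (ℕ; zero; suc; _≤_; _<_; s≤s; z≤n)
open import Data.Fin using (Fin; toℕ) renaming (zero to fz; suc to fs)
open import Data.Fin.Properties using (_≟_)
open import Data.Vec as V using ([]; _∷_; replicate; _[_]≔_)
open import Data.Vec.Properties using (lookup-replicate; lookup∘update; lookup∘update′; ∷-injectiveʳ; ≡-dec)
open import Data.Vec.Relation.Binary.Pointwise.Inductive using ([]; _∷_)
import Data.Vec.Relation.Binary.Pointwise.Inductive as Pointwise
open import Data.Vec.Relation.Unary.All as AllV using ([]; _∷_)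
open import Data.Vec.Relation.Unary.All.Properties using (lookup⁻)
open import Data.List using (List; []; _∷_; length; lookup; take; _++_; map; [_])
open import Data.List.Properties using (++-identityʳ; ++-assoc; map-++)
open import Data.List.Membership.Propositional using (_∈_)
open import Data.List.Membership.Propositional.Properties using (∈-++⁺ˡ; ∈-++⁺ʳ; ∈-++⁻; ∈-map⁺; ∈-map⁻; ∈-lookup)
open import Data.List.Relation.Unary.Any using (here; there)
open import Data.List.Relation.Unary.All as AllL using (All; []; _∷_)
open import Data.List.Relation.Unary.AllPairs using ([]; _∷_)
open import Data.List.Relation.Unary.Unique.Propositional using (Unique)
open import Data.List.Relation.Binary.Disjoint.Propositional using (Disjoint)
import Data.List.Relation.Unary.Unique.Propositional.Properties as Unique
open import Data.Product using (∃-syntax; _×_; _,_; proj₁; proj₂)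
open import Data.Sum using (_⊎_; inj₁; inj₂; [_,_]′)
open import Data.Empty using (⊥-elim)
open import Data.Unit using (⊤; tt)
open import Relation.Binary.PropositionalEquality using (_≡_; _≢_; refl; sym; trans; cong; subst; module ≡-Reasoning)
open ≡-Reasoning
open import Relation.Nullary using (yes; no)
open import Function.Bundles using (_⇔_; mk⇔; Equivalence)

pattern one   = fs fz
pattern two   = fs (fs fz)
pattern three = fs (fs (fs fz))

Full : ∀ {n} → Str n → Set
Full = AllV.All (_≢ fz)

NonConstant : ∀ {n} → Str n → Set
NonConstant {n} X = ∀ c → X ≢ replicate n c

⊑-refl : ∀ {n} {X : Str n} → X ⊑ X
⊑-refl = Pointwise.refl (inj₂ refl)

[]≔0-⊑ : ∀ {n} (F : Str n) j → (F [ j ]≔ fz) ⊑ F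
[]≔0-⊑ (x ∷ F) fz     = inj₁ refl ∷ ⊑-refl
[]≔0-⊑ (x ∷ F) (fs j) = inj₂ refl ∷ []≔0-⊑ F j

[]≔0-⊑-[]≔ : ∀ {n} (F : Str n) j v → (F [ j ]≔ fz) ⊑ (F [ j ]≔ v)
[]≔0-⊑-[]≔ (x ∷ F) fz     v = inj₁ refl ∷ ⊑-refl
[]≔0-⊑-[]≔ (x ∷ F) (fs j) v = inj₂ refl ∷ []≔0-⊑-[]≔ F j v

⊑-[]≔ : ∀ {n} (F : Str n) j v → V.lookup F j ≡ fz → F ⊑ (F [ j ]≔ v)
⊑-[]≔ (x ∷ F) fz     v e = inj₁ e ∷ ⊑-refl
⊑-[]≔ (x ∷ F) (fs j) v e = inj₂ refl ∷ ⊑-[]≔ F j v e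

⊑-[]≔0 : ∀ {n} {G F F' : Str n} j → G ⊑ F → G ⊑ F' → V.lookup F j ≢ V.lookup F' j →
         G ⊑ (F [ j ]≔ fz)
⊑-[]≔0 fz     (inj₁ e  ∷ p) _             _  = inj₁ e ∷ p
⊑-[]≔0 fz     (inj₂ _  ∷ p) (inj₁ e  ∷ _) _  = inj₁ e ∷ p
⊑-[]≔0 fz     (inj₂ e  ∷ _) (inj₂ e' ∷ _) ne = ⊥-elim (ne (trans (sym e) e'))
⊑-[]≔0 (fs j) (a ∷ p)       (_ ∷ q)       ne = a ∷ ⊑-[]≔0 j p q ne

Full-[]≔ : ∀ {n} {F : Str n} j {v} → v ≢ fz → Full F → Full (F [ j ]≔ v)
Full-[]≔ fz     v≢0 (_ ∷ f) = v≢0 ∷ f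
Full-[]≔ (fs j) v≢0 (x ∷ f) = x ∷ Full-[]≔ j v≢0 f

size-[]≔0 : ∀ {n} {F : Str n} j → Full F → suc (size (F [ j ]≔ fz)) ≡ size F
size-[]≔0 {F = fz   ∷ F} _      (x≢0 ∷ _) = ⊥-elim (x≢0 refl)
size-[]≔0 {F = fs _ ∷ F} fz     _         = refl
size-[]≔0 {F = fs _ ∷ F} (fs j) (_ ∷ f)   = cong suc (size-[]≔0 j f)

Full-maximal : ∀ {n} {F G : Str n} → Full F → F ⊑ G → G ≡ F
Full-maximal []        []              = refl
Full-maximal (x≢0 ∷ _) (inj₁ e ∷ _)    = ⊥-elim (x≢0 e)
Full-maximal (_ ∷ f)   (inj₂ refl ∷ p) = cong (_ ∷_) (Full-maximal f p)

Full-replicate : ∀ n {c : Fin 4} → c ≢ fz → Full (replicate n c)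
Full-replicate zero    c≢0 = []
Full-replicate (suc n) c≢0 = c≢0 ∷ Full-replicate n c≢0

nonConstant-∷ : ∀ {n} {a} {s : Str n} → NonConstant s → NonConstant (a ∷ s)
nonConstant-∷ nc c e = nc c (∷-injectiveʳ e)

lookup-≢⇒nonConstant : ∀ {n} {X : Str n} i j → V.lookup X i ≢ V.lookup X j → NonConstant X
lookup-≢⇒nonConstant i j ne c refl =
  ne (trans (lookup-replicate i c) (sym (lookup-replicate j c)))

≢replicate⇒lookup-≢ : ∀ {k} (c : Fin 4) (t : Str k) → t ≢ replicate k c → ∃[ j ] V.lookup t j ≢ c
≢replicate⇒lookup-≢ c []      ne = ⊥-elim (ne refl)
≢replicate⇒lookup-≢ c (x ∷ t) ne with x ≟ c
... | no x≢c  = fz , x≢c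
... | yes refl with ≢replicate⇒lookup-≢ c t (λ e → ne (cong (x ∷_) e))
...   | j , p = fs j , p

constant⊎nonConstant : ∀ {k} (s : Str (suc k)) → (∃[ c ] s ≡ replicate _ c) ⊎ NonConstant s
constant⊎nonConstant s with ≡-dec _≟_ s (replicate _ (V.head s))
... | yes e = inj₁ (_ , e)
... | no ne = inj₂ λ { c refl → ne refl }

other : Fin 4 → Fin 4
other one = two
other _   = one

other-≢ : ∀ x → other x ≢ x
other-≢ fz    ()
other-≢ one   ()
other-≢ two   ()
other-≢ three ()

other-≢0 : ∀ x → other x ≢ fz
other-≢0 fz    ()
other-≢0 one   ()
other-≢0 two   ()
other-≢0 three ()

nonConstant⇒T3 : ∀ {n} {X : Str n} → NonConstant X → T3 n X
nonConstant⇒T3 nc = nc one , nc two , nc three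

T3⇒nonConstant : ∀ {k} {X : Str (suc k)} → Full X → T3 (suc k) X → NonConstant X
T3⇒nonConstant (x≢0 ∷ _) _           fz    refl = x≢0 refl
T3⇒nonConstant _         (ne , _)     one   = ne
T3⇒nonConstant _         (_ , ne , _) two   = ne
T3⇒nonConstant _         (_ , _ , ne) three = ne

neighbour : ∀ {m} → Fin (suc (suc m)) → Fin (suc (suc m))
neighbour fz     = one
neighbour (fs _) = fz

neighbour-≢ : ∀ {m} (j : Fin (suc (suc m))) → neighbour j ≢ j
neighbour-≢ fz     ()
neighbour-≢ (fs _) ()

-- Filling a blank entry with a letter different from a neighbouring entry gives a larger face.
facet⇒Full : ∀ {m} {F : Str (suc (suc m))} → IsFacet (T3 _) F → Full F
facet⇒Full {F = F} (_ , maximal) = lookup⁻ blank-free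
  where
  blank-free : ∀ j → V.lookup F j ≢ fz
  blank-free j Fj≡0 = other-≢0 _ (begin
      v                        ≡⟨ sym (lookup∘update j F v) ⟩
      V.lookup (F [ j ]≔ v) j  ≡⟨ cong (λ X → V.lookup X j) filled≡F ⟩
      V.lookup F j             ≡⟨ Fj≡0 ⟩
      fz                       ∎)
    where
    v = other (V.lookup F (neighbour j))
    filled-nonConstant : NonConstant (F [ j ]≔ v)
    filled-nonConstant = lookup-≢⇒nonConstant j (neighbour j) λ e →
      other-≢ _ (trans (sym (lookup∘update j F v)) (trans e (lookup∘update′ (neighbour-≢ j) F v)))
    filled≡F : F [ j ]≔ v ≡ F
    filled≡F = maximal _ (nonConstant⇒T3 filled-nonConstant) (⊑-[]≔ F j v Fj≡0)

facet⇔Full×NonConstant : ∀ {m} (F : Str (suc (suc m))) → IsFacet (T3 _) F ⇔ (Full F × NonConstant F)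
facet⇔Full×NonConstant F = mk⇔
  (λ facet → facet⇒Full facet , T3⇒nonConstant (facet⇒Full facet) (proj₁ facet))
  (λ (full , nc) → nonConstant⇒T3 nc , λ _ _ F⊑G → Full-maximal full F⊑G)

-- The usual reformulation of the shelling condition: F ∩ F' ⊆ F ∖ {vertex at j} ⊆ F'' with F'' ∈ P.
Attachable : ∀ {n} → List (Str n) → Str n → Set
Attachable {n} P F = ∀ F' → F' ∈ P → F' ≢ F →
  ∃[ j ] (V.lookup F j ≢ V.lookup F' j) × ∃[ F'' ] F'' ∈ P × (F [ j ]≔ fz) ⊑ F''

AllAttachable : ∀ {n} → List (Str n) → List (Str n) → Set
AllAttachable P []      = ⊤
AllAttachable P (F ∷ L) = Attachable P F × AllAttachable (P ++ [ F ]) L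

AllAttachable-++ : ∀ {n} (P X : List (Str n)) {Y} →
                   AllAttachable P X → AllAttachable (P ++ X) Y → AllAttachable P (X ++ Y)
AllAttachable-++ P []      a b rewrite ++-identityʳ P = b
AllAttachable-++ P (F ∷ X) {Y} (g , a) b =
  g , AllAttachable-++ (P ++ [ F ]) X a (subst (λ Q → AllAttachable Q Y) (sym (++-assoc P [ F ] X)) b)

attachable-lookup : ∀ {n} (P L : List (Str n)) → AllAttachable P L →
                    ∀ k → Attachable (P ++ take (toℕ k) L) (lookup L k)
attachable-lookup P (F ∷ L) (g , _) fz rewrite ++-identityʳ P = g
attachable-lookup P (F ∷ L) (_ , a) (fs k) =
  subst (λ Q → Attachable Q (lookup L k)) (++-assoc P [ F ] (take (toℕ k) L)) (attachable-lookup (P ++ [ F ]) L a k)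

lookup∈take : ∀ {A : Set} (L : List A) {i k : Fin (length L)} → toℕ i < toℕ k → lookup L i ∈ take (toℕ k) L
lookup∈take (x ∷ L) {fz}   {fs k} _         = here refl
lookup∈take (x ∷ L) {fs i} {fs k} (s≤s i<k) = there (lookup∈take L i<k)

∈take⇒lookup : ∀ {A : Set} {x : A} (L : List A) (k : Fin (length L)) → x ∈ take (toℕ k) L →
               ∃[ i ] (toℕ i < toℕ k) × lookup L i ≡ x
∈take⇒lookup (y ∷ L) (fs k) (here e) = fz , s≤s z≤n , sym e
∈take⇒lookup (y ∷ L) (fs k) (there m) with ∈take⇒lookup L k m
... | i , i<k , e = fs i , s≤s i<k , e

unique⇒lookup-≢ : ∀ {A : Set} {L : List A} → Unique L → {i k : Fin (length L)} → toℕ i < toℕ k →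
                  lookup L i ≢ lookup L k
unique⇒lookup-≢ (x∉ ∷ _) {fz}   {fs k} _         = AllL.lookup x∉ (∈-lookup k)
unique⇒lookup-≢ (_ ∷ u) {fs i} {fs k} (s≤s i<k) = unique⇒lookup-≢ u i<k

attachable⇒shellingStep : ∀ {n} (L : List (Str n)) → Unique L → (∀ F → F ∈ L → Full F) →
                          AllAttachable [] L → ∀ k → ShellingStep L k
attachable⇒shellingStep L unique full attachable k G G⊑F (i , i<k , G⊑Fi)
  with attachable-lookup [] L attachable k (lookup L i) (lookup∈take L i<k) (unique⇒lookup-≢ unique i<k)
... | j , Fj≢ , _ , F''∈ , F∖j⊑F'' with ∈take⇒lookup L k F''∈
... | i' , i'<k , refl =
  lookup L k [ j ]≔ fz , ⊑-[]≔0 j G⊑F G⊑Fi Fj≢ , []≔0-⊑ (lookup L k) j ,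
  (i' , i'<k , F∖j⊑F'') , size-[]≔0 j (full _ (∈-lookup k))

block : ∀ {k} → List (Str k) → Fin 4 → Fin 4 → Fin 4 → List (Str (suc k))
block {k} Om a c d = map (a ∷_) Om ++ (a ∷ replicate k c) ∷ (a ∷ replicate k d) ∷ []

blocks : ∀ {k} → List (Str k) → List (Str (suc k))
blocks Om = block Om one two three ++ block Om two one three ++ block Om three one two

-- For n = 2 the block order 12, 13, 21, … is not a shelling (21 meets 12 and 13 only in ∅).
order : (m : ℕ) → List (Str (suc (suc m)))
order zero    = (one ∷ two ∷ []) ∷ (three ∷ two ∷ []) ∷ (three ∷ one ∷ []) ∷
                (two ∷ one ∷ []) ∷ (two ∷ three ∷ []) ∷ (one ∷ three ∷ []) ∷ []
order (suc m) = blocks (order m)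

∈-block⁻ : ∀ {k} {Om : List (Str k)} {a c d F} → F ∈ block Om a c d →
           (∃[ s ] s ∈ Om × F ≡ a ∷ s) ⊎ F ≡ a ∷ replicate k c ⊎ F ≡ a ∷ replicate k d
∈-block⁻ {Om = Om} {a} F∈ with ∈-++⁻ (map (a ∷_) Om) F∈
... | inj₁ F∈map                = inj₁ (∈-map⁻ (a ∷_) F∈map)
... | inj₂ (here refl)          = inj₂ (inj₁ refl)
... | inj₂ (there (here refl))  = inj₂ (inj₂ refl)

head-∈-block : ∀ {k} {Om : List (Str k)} {a c d F} → F ∈ block Om a c d → V.head F ≡ a
head-∈-block F∈ with ∈-block⁻ F∈
... | inj₁ (_ , _ , refl)  = refl
... | inj₂ (inj₁ refl)     = refl
... | inj₂ (inj₂ refl)     = refl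

block-sound : ∀ {k} {Om : List (Str (suc k))} → (∀ s → s ∈ Om → Full s × NonConstant s) →
              ∀ {a c d} → a ≢ fz → c ≢ fz → d ≢ fz → a ≢ c → a ≢ d →
              ∀ F → F ∈ block Om a c d → Full F × NonConstant F
block-sound Om-sound a≢0 c≢0 d≢0 a≢c a≢d F F∈ with ∈-block⁻ F∈
... | inj₁ (s , s∈ , refl) = a≢0 ∷ proj₁ (Om-sound s s∈) , nonConstant-∷ (proj₂ (Om-sound s s∈))
... | inj₂ (inj₁ refl)     = a≢0 ∷ Full-replicate _ c≢0 , lookup-≢⇒nonConstant fz one a≢c
... | inj₂ (inj₂ refl)     = a≢0 ∷ Full-replicate _ d≢0 , lookup-≢⇒nonConstant fz one a≢d

blocks-sound : ∀ {k} {Om : List (Str (suc k))} → (∀ s → s ∈ Om → Full s × NonConstant s) →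
               ∀ F → F ∈ blocks Om → Full F × NonConstant F
blocks-sound {Om = Om} Om-sound F F∈ with ∈-++⁻ (block Om one two three) F∈
... | inj₁ F∈₁ = block-sound Om-sound (λ ()) (λ ()) (λ ()) (λ ()) (λ ()) F F∈₁
... | inj₂ F∈₂₃ with ∈-++⁻ (block Om two one three) F∈₂₃
...   | inj₁ F∈₂ = block-sound Om-sound (λ ()) (λ ()) (λ ()) (λ ()) (λ ()) F F∈₂
...   | inj₂ F∈₃ = block-sound Om-sound (λ ()) (λ ()) (λ ()) (λ ()) (λ ()) F F∈₃

pair-sound : ∀ {x y : Fin 4} → x ≢ fz → y ≢ fz → x ≢ y → Full (x ∷ y ∷ []) × NonConstant (x ∷ y ∷ [])
pair-sound x≢0 y≢0 x≢y = x≢0 ∷ y≢0 ∷ [] , lookup-≢⇒nonConstant fz one x≢y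

order-sound : ∀ m F → F ∈ order m → Full F × NonConstant F
order-sound zero    _ = AllL.lookup {P = λ F → Full F × NonConstant F}
  (pair-sound (λ ()) (λ ()) (λ ()) ∷ pair-sound (λ ()) (λ ()) (λ ()) ∷ pair-sound (λ ()) (λ ()) (λ ()) ∷
   pair-sound (λ ()) (λ ()) (λ ()) ∷ pair-sound (λ ()) (λ ()) (λ ()) ∷ pair-sound (λ ()) (λ ()) (λ ()) ∷ [])
order-sound (suc m) = blocks-sound (order-sound m)

module _ {k} (Om : List (Str k)) where

  ∷-∈-block : ∀ {a c d s} → s ∈ Om → a ∷ s ∈ block Om a c d
  ∷-∈-block {a = a} s∈ = ∈-++⁺ˡ (∈-map⁺ (a ∷_) s∈)

  ∷replicate₁-∈-block : ∀ {a c d} → a ∷ replicate k c ∈ block Om a c d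
  ∷replicate₁-∈-block {a} = ∈-++⁺ʳ (map (a ∷_) Om) (here refl)

  ∷replicate₂-∈-block : ∀ {a c d} → a ∷ replicate k d ∈ block Om a c d
  ∷replicate₂-∈-block {a} = ∈-++⁺ʳ (map (a ∷_) Om) (there (here refl))

  ∈-blocks₁ : ∀ {F} → F ∈ block Om one two three → F ∈ blocks Om
  ∈-blocks₁ = ∈-++⁺ˡ

  ∈-blocks₂ : ∀ {F} → F ∈ block Om two one three → F ∈ blocks Om
  ∈-blocks₂ F∈ = ∈-++⁺ʳ (block Om one two three) (∈-++⁺ˡ F∈)

  ∈-blocks₃ : ∀ {F} → F ∈ block Om three one two → F ∈ blocks Om
  ∈-blocks₃ F∈ = ∈-++⁺ʳ (block Om one two three) (∈-++⁺ʳ (block Om two one three) F∈)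

  ∷-∈-blocks : ∀ {a s} → a ≢ fz → s ∈ Om → a ∷ s ∈ blocks Om
  ∷-∈-blocks {a = fz}    a≢0 _  = ⊥-elim (a≢0 refl)
  ∷-∈-blocks {a = one}   _   s∈ = ∈-blocks₁ (∷-∈-block s∈)
  ∷-∈-blocks {a = two}   _   s∈ = ∈-blocks₂ (∷-∈-block s∈)
  ∷-∈-blocks {a = three} _   s∈ = ∈-blocks₃ (∷-∈-block s∈)

  ∷replicate-∈-blocks : ∀ {a c} → a ≢ fz → c ≢ fz → a ≢ c →
                        a ∷ replicate k c ∈ blocks Om
  ∷replicate-∈-blocks {a = fz}               a≢0 _   _   = ⊥-elim (a≢0 refl)
  ∷replicate-∈-blocks {c = fz}               _   c≢0 _   = ⊥-elim (c≢0 refl)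
  ∷replicate-∈-blocks {a = one}   {one}      _   _   a≢c = ⊥-elim (a≢c refl)
  ∷replicate-∈-blocks {a = one}   {two}      _   _   _   = ∈-blocks₁ ∷replicate₁-∈-block
  ∷replicate-∈-blocks {a = one}   {three}    _   _   _   = ∈-blocks₁ ∷replicate₂-∈-block
  ∷replicate-∈-blocks {a = two}   {one}      _   _   _   = ∈-blocks₂ ∷replicate₁-∈-block
  ∷replicate-∈-blocks {a = two}   {two}      _   _   a≢c = ⊥-elim (a≢c refl)
  ∷replicate-∈-blocks {a = two}   {three}    _   _   _   = ∈-blocks₂ ∷replicate₂-∈-block
  ∷replicate-∈-blocks {a = three} {one}      _   _   _   = ∈-blocks₃ ∷replicate₁-∈-block
  ∷replicate-∈-blocks {a = three} {two}      _   _   _   = ∈-blocks₃ ∷replicate₂-∈-block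
  ∷replicate-∈-blocks {a = three} {three}    _   _   a≢c = ⊥-elim (a≢c refl)

order-complete : ∀ m F → Full F → NonConstant F → F ∈ order m
order-complete zero (one   ∷ one   ∷ []) _ nc = ⊥-elim (nc one refl)
order-complete zero (one   ∷ two   ∷ []) _ _  = here refl
order-complete zero (one   ∷ three ∷ []) _ _  = there (there (there (there (there (here refl)))))
order-complete zero (two   ∷ one   ∷ []) _ _  = there (there (there (here refl)))
order-complete zero (two   ∷ two   ∷ []) _ nc = ⊥-elim (nc two refl)
order-complete zero (two   ∷ three ∷ []) _ _  = there (there (there (there (here refl))))
order-complete zero (three ∷ one   ∷ []) _ _  = there (there (here refl))
order-complete zero (three ∷ two   ∷ []) _ _  = there (here refl)
order-complete zero (three ∷ three ∷ []) _ nc = ⊥-elim (nc three refl)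
order-complete zero (fz ∷ _ ∷ [])        (x≢0 ∷ _)     _ = ⊥-elim (x≢0 refl)
order-complete zero (_  ∷ fz ∷ [])       (_ ∷ y≢0 ∷ _) _ = ⊥-elim (y≢0 refl)
order-complete (suc m) (a ∷ s) (a≢0 ∷ s-full) nc with constant⊎nonConstant s
... | inj₁ (c , refl) = ∷replicate-∈-blocks (order m) a≢0 (AllV.head s-full) λ { refl → nc a refl }
... | inj₂ s-nc       = ∷-∈-blocks (order m) a≢0 (order-complete m s s-full s-nc)

block-unique : ∀ {k} {Om : List (Str (suc k))} → Unique Om → (∀ s → s ∈ Om → NonConstant s) →
               ∀ {a c d} → c ≢ d → Unique (block Om a c d)
block-unique {Om = Om} unique nonConstant {a} {c} {d} c≢d =
  Unique.++⁺ (Unique.map⁺ ∷-injectiveʳ unique) (((λ e → c≢d (cong V.head (∷-injectiveʳ e))) ∷ []) ∷ [] ∷ [])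
             rows-not-constant
  where
  rows-not-constant : Disjoint (map (a ∷_) Om) ((a ∷ replicate _ c) ∷ (a ∷ replicate _ d) ∷ [])
  rows-not-constant (F∈map , F∈constants) with ∈-map⁻ (a ∷_) F∈map
  rows-not-constant (_ , here e)         | s , s∈ , refl = nonConstant s s∈ c (∷-injectiveʳ e)
  rows-not-constant (_ , there (here e)) | s , s∈ , refl = nonConstant s s∈ d (∷-injectiveʳ e)

head-∈-block-≢ : ∀ {k} {Om : List (Str k)} {a b c d F} → F ∈ block Om a c d → a ≢ b → V.head F ≢ b
head-∈-block-≢ F∈ a≢b e = a≢b (trans (sym (head-∈-block F∈)) e)

block-disjoint : ∀ {k} {Om : List (Str k)} {a b c d c' d'} → a ≢ b →
                 Disjoint (block Om a c d) (block Om b c' d')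
block-disjoint a≢b (F∈₁ , F∈₂) = head-∈-block-≢ F∈₁ a≢b (head-∈-block F∈₂)

blocks-unique : ∀ {k} {Om : List (Str (suc k))} → Unique Om → (∀ s → s ∈ Om → NonConstant s) →
                Unique (blocks Om)
blocks-unique {Om = Om} unique nonConstant =
  Unique.++⁺ (block-unique unique nonConstant (λ ()))
             (Unique.++⁺ (block-unique unique nonConstant (λ ())) (block-unique unique nonConstant (λ ()))
                         (block-disjoint (λ ())))
             λ (F∈₁ , F∈₂₃) → [ (λ F∈₂ → block-disjoint (λ ()) (F∈₁ , F∈₂))
                              , (λ F∈₃ → block-disjoint (λ ()) (F∈₁ , F∈₃))
                              ]′ (∈-++⁻ (block Om two one three) F∈₂₃)

order-unique : ∀ m → Unique (order m)
order-unique zero    = ((λ ()) ∷ (λ ()) ∷ (λ ()) ∷ (λ ()) ∷ (λ ()) ∷ []) ∷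
                       ((λ ()) ∷ (λ ()) ∷ (λ ()) ∷ (λ ()) ∷ []) ∷
                       ((λ ()) ∷ (λ ()) ∷ (λ ()) ∷ []) ∷
                       ((λ ()) ∷ (λ ()) ∷ []) ∷
                       ((λ ()) ∷ []) ∷ [] ∷ []
order-unique (suc m) = blocks-unique (order-unique m) (λ s s∈ → proj₂ (order-sound m s s∈))

-- Quantified over F' ∈ P so that it holds vacuously for the first block.
EarlierBlocks : ∀ {k} → List (Str k) → List (Str (suc k)) → Fin 4 → Set
EarlierBlocks Om P a = ∀ F' → F' ∈ P → V.head F' ≢ a × (∀ s → s ∈ Om → one ∷ s ∈ P)

module _ {k} (Om : List (Str (suc (suc k)))) (Om-complete : ∀ s → Full s → NonConstant s → s ∈ Om) where

  ∷-attachable : ∀ {P Q a s} → EarlierBlocks Om P a → s ∈ Om → Attachable Q s →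
                 Attachable (P ++ map (a ∷_) Q) (a ∷ s)
  ∷-attachable {P} {Q} {a} {s} earlier s∈ attachable F'@(_ ∷ _) F'∈ F'≢ with ∈-++⁻ P F'∈
  ... | inj₁ F'∈P =
    let head≢ , row₁⊆P = earlier F' F'∈P
    in fz , (λ e → head≢ (sym e)) , one ∷ s , ∈-++⁺ˡ (row₁⊆P s s∈) , inj₁ refl ∷ ⊑-refl
  ... | inj₂ F'∈Q with ∈-map⁻ (a ∷_) F'∈Q
  ... | t , t∈ , refl with attachable t t∈ (λ e → F'≢ (cong (a ∷_) e))
  ... | j , sj≢tj , s'' , s''∈ , s∖j⊑s'' =
    fs j , sj≢tj , a ∷ s'' , ∈-++⁺ʳ P (∈-map⁺ (a ∷_) s''∈) , inj₂ refl ∷ s∖j⊑s''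

  map-∷-attachable : ∀ {P a} Q X → EarlierBlocks Om P a → (∀ s → s ∈ X → s ∈ Om) →
                     AllAttachable Q X → AllAttachable (P ++ map (a ∷_) Q) (map (a ∷_) X)
  map-∷-attachable Q []      _       _   _ = tt
  map-∷-attachable {P} {a} Q (s ∷ X) earlier X⊆Om (attachable , rest) =
    ∷-attachable earlier (X⊆Om s (here refl)) attachable ,
    subst (λ R → AllAttachable R (map (a ∷_) X)) prefix≡
          (map-∷-attachable (Q ++ [ s ]) X earlier (λ t t∈ → X⊆Om t (there t∈)) rest)
    where
    prefix≡ : P ++ map (a ∷_) (Q ++ [ s ]) ≡ (P ++ map (a ∷_) Q) ++ [ a ∷ s ]
    prefix≡ = trans (cong (P ++_) (map-++ (a ∷_) Q [ s ])) (sym (++-assoc P (map (a ∷_) Q) [ a ∷ s ]))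

  -- If t has a letter other than c at j, then F ∩ F' lies in a ∷ (c ⋯ c with another letter at j),
  -- which is non-constant and hence listed earlier in the row a ∷ Om.
  ∷replicate-attachable : ∀ {P a c} → c ≢ fz → (∀ s → s ∈ Om → a ∷ s ∈ P) → Attachable P (a ∷ replicate _ c)
  ∷replicate-attachable {P} {a} {c} c≢0 row⊆P (b ∷ t) F'∈ F'≢ with ≡-dec _≟_ t (replicate _ c)
  ... | yes refl = fz , (λ { refl → F'≢ refl }) , b ∷ t , F'∈ , inj₁ refl ∷ ⊑-refl
  ... | no t≢c with ≢replicate⇒lookup-≢ c t t≢c
  ... | j , tj≢c =
    fs j , (λ e → tj≢c (trans (sym e) (lookup-replicate j c))) ,
    a ∷ filled , row⊆P filled (Om-complete filled filled-full filled-nonConstant) ,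
    inj₂ refl ∷ []≔0-⊑-[]≔ (replicate _ c) j (other c)
    where
    filled = replicate _ c [ j ]≔ other c
    filled-full : Full filled
    filled-full = Full-[]≔ j (other-≢0 c) (Full-replicate _ c≢0)
    filled-nonConstant : NonConstant filled
    filled-nonConstant = lookup-≢⇒nonConstant j (neighbour j) λ e → other-≢ c (begin
      other c                                     ≡⟨ sym (lookup∘update j (replicate _ c) (other c)) ⟩
      V.lookup filled j                           ≡⟨ e ⟩
      V.lookup filled (neighbour j)               ≡⟨ lookup∘update′ (neighbour-≢ j) (replicate _ c) (other c) ⟩
      V.lookup (replicate _ c) (neighbour j)      ≡⟨ lookup-replicate (neighbour j) c ⟩
      c                                           ∎)

  block-attachable : AllAttachable [] Om → ∀ {P a c d} → c ≢ fz → d ≢ fz → EarlierBlocks Om P a →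
                     AllAttachable P (block Om a c d)
  block-attachable Om-attachable {P} {a} c≢0 d≢0 earlier =
    AllAttachable-++ P (map (a ∷_) Om)
      (subst (λ R → AllAttachable R (map (a ∷_) Om)) (++-identityʳ P)
             (map-∷-attachable [] Om earlier (λ _ s∈ → s∈) Om-attachable))
      (∷replicate-attachable c≢0 row⊆ , ∷replicate-attachable d≢0 (λ s s∈ → ∈-++⁺ˡ (row⊆ s s∈)) , tt)
    where
    row⊆ : ∀ s → s ∈ Om → a ∷ s ∈ P ++ map (a ∷_) Om
    row⊆ s s∈ = ∈-++⁺ʳ P (∈-map⁺ (a ∷_) s∈)

  blocks-attachable : AllAttachable [] Om → AllAttachable [] (blocks Om)
  blocks-attachable Om-attachable =
    AllAttachable-++ [] B₁ (block-attachable Om-attachable (λ ()) (λ ()) (λ _ ()))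
      (AllAttachable-++ B₁ B₂ (block-attachable Om-attachable (λ ()) (λ ()) after₁)
                              (block-attachable Om-attachable (λ ()) (λ ()) after₁₂))
    where
    B₁ = block Om one two three
    B₂ = block Om two one three
    row₁⊆B₁ : ∀ s → s ∈ Om → one ∷ s ∈ B₁
    row₁⊆B₁ s s∈ = ∷-∈-block Om s∈
    after₁ : EarlierBlocks Om B₁ two
    after₁ F' F'∈ = head-∈-block-≢ F'∈ (λ ()) , row₁⊆B₁
    after₁₂ : EarlierBlocks Om (B₁ ++ B₂) three
    after₁₂ F' F'∈ =
      [ (λ F'∈₁ → head-∈-block-≢ F'∈₁ (λ ())) , (λ F'∈₂ → head-∈-block-≢ F'∈₂ (λ ())) ]′
        (∈-++⁻ B₁ F'∈) ,
      λ s s∈ → ∈-++⁺ˡ (row₁⊆B₁ s s∈)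

order-attachable : ∀ m → AllAttachable [] (order m)
order-attachable zero = (λ _ ()) , at₃₂ , at₃₁ , at₂₁ , at₂₃ , at₁₃ , tt
  where
  at₃₂ : Attachable _ (three ∷ two ∷ [])
  at₃₂ _ (here refl) _ = fz , (λ ()) , _ , here refl , inj₁ refl ∷ inj₂ refl ∷ []
  at₃₁ : Attachable _ (three ∷ one ∷ [])
  at₃₁ _ (here refl) _ = one , (λ ()) , _ , there (here refl) , inj₂ refl ∷ inj₁ refl ∷ []
  at₃₁ _ (there (here refl)) _ = one , (λ ()) , _ , there (here refl) , inj₂ refl ∷ inj₁ refl ∷ []
  at₂₁ : Attachable _ (two ∷ one ∷ [])
  at₂₁ _ (here refl) _ = fz , (λ ()) , _ , there (there (here refl)) , inj₁ refl ∷ inj₂ refl ∷ []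
  at₂₁ _ (there (here refl)) _ = fz , (λ ()) , _ , there (there (here refl)) , inj₁ refl ∷ inj₂ refl ∷ []
  at₂₁ _ (there (there (here refl))) _ = fz , (λ ()) , _ , there (there (here refl)) , inj₁ refl ∷ inj₂ refl ∷ []
  at₂₃ : Attachable _ (two ∷ three ∷ [])
  at₂₃ _ (here refl) _ = one , (λ ()) , _ , there (there (there (here refl))) , inj₂ refl ∷ inj₁ refl ∷ []
  at₂₃ _ (there (here refl)) _ = one , (λ ()) , _ , there (there (there (here refl))) , inj₂ refl ∷ inj₁ refl ∷ []
  at₂₃ _ (there (there (here refl))) _ = one , (λ ()) , _ , there (there (there (here refl))) , inj₂ refl ∷ inj₁ refl ∷ []
  at₂₃ _ (there (there (there (here refl)))) _ = one , (λ ()) , _ , there (there (there (here refl))) , inj₂ refl ∷ inj₁ refl ∷ []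
  at₁₃ : Attachable _ (one ∷ three ∷ [])
  at₁₃ _ (here refl) _ = one , (λ ()) , _ , here refl , inj₂ refl ∷ inj₁ refl ∷ []
  at₁₃ _ (there (here refl)) _ = fz , (λ ()) , _ , there (there (there (there (here refl)))) , inj₁ refl ∷ inj₂ refl ∷ []
  at₁₃ _ (there (there (here refl))) _ = fz , (λ ()) , _ , there (there (there (there (here refl)))) , inj₁ refl ∷ inj₂ refl ∷ []
  at₁₃ _ (there (there (there (here refl)))) _ = fz , (λ ()) , _ , there (there (there (there (here refl)))) , inj₁ refl ∷ inj₂ refl ∷ []
  at₁₃ _ (there (there (there (there (here refl))))) _ = fz , (λ ()) , _ , there (there (there (there (here refl)))) , inj₁ refl ∷ inj₂ refl ∷ []
order-attachable (suc m) = blocks-attachable (order m) (λ s → order-complete m s) (order-attachable m)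

order-isShelling : ∀ m → IsShelling (T3 (suc (suc m))) (order m)
order-isShelling m =
  order-unique m ,
  (λ F → mk⇔ (λ F∈ → Equivalence.from (facet⇔Full×NonConstant F) (order-sound m F F∈))
             (λ facet → let full , nc = Equivalence.to (facet⇔Full×NonConstant F) facet
                        in order-complete m F full nc)) ,
  λ k _ → attachable⇒shellingStep (order m) (order-unique m) (λ F F∈ → proj₁ (order-sound m F F∈))
                                  (order-attachable m) k

T3₁-face≡blank : ∀ G → T3 1 G → G ≡ fz ∷ []
T3₁-face≡blank (fz    ∷ []) _            = refl
T3₁-face≡blank (one   ∷ []) (ne , _)     = ⊥-elim (ne refl)
T3₁-face≡blank (two   ∷ []) (_ , ne , _) = ⊥-elim (ne refl)
T3₁-face≡blank (three ∷ []) (_ , _ , ne) = ⊥-elim (ne refl)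

T3₁-isShelling : IsShelling (T3 1) [ fz ∷ [] ]
T3₁-isShelling =
  ([] ∷ []) ,
  (λ F → mk⇔ (λ { (here refl) → ((λ ()) , (λ ()) , (λ ())) , λ G G-face _ → T3₁-face≡blank G G-face })
             (λ (F-face , _) → here (T3₁-face≡blank F F-face))) ,
  λ { fz () }

mainTheorem2 : (n : ℕ) → 1 ≤ n → Shellable (T3 n)
mainTheorem2 (suc zero)    _ = [ fz ∷ [] ] , T3₁-isShelling
mainTheorem2 (suc (suc m)) _ = order m , order-isShelling m
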